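{- For every 3-regular graph $G$, the line graph of $G$ is 4-star colourable if and only if $G$ is bipartite and distance-two 4-colourable.
   Context: Graphs are finite and simple. A $k$-colouring is a map $f\colon V(G)\to\mathbb{Z}_k$ with adjacent vertices receiving distinct colours; a bicoloured component of $(G,f)$ is a connected component of the subgraph induced by two colour classes. A $k$-star colouring is a $k$-colouring in which every bicoloured component is a star $K_{1,q}$ ($q\ge 0$). A distance-two $k$-colouring is a $k$-colouring in which every bicoloured component is $K_1$ or $K_2$ (equivalently, vertices at distance at most 2 receive distinct colours). -}

module Defs where

open import Data.Nat using (ℕ; _<_)
open import Data.Fin using (Fin; toℕ)
open import Data.Bool using (Bool; true; false; T)
open import Data.List using (length; filterᵇ; allFin)
open import Data.Product using (Σ; Σ-syntax; ∃; _×_; _,_; proj₁; proj₂)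
open import Data.Sum using (_⊎_)
open import Relation.Nullary using (¬_)
open import Relation.Binary.PropositionalEquality using (_≡_; _≢_)

record SimpleGraph (n : ℕ) : Set where
  field
    adj     : Fin n → Fin n → Bool
    symm    : ∀ u v → adj u v ≡ adj v u
    irrefl  : ∀ v → adj v v ≡ false
open SimpleGraph public

degree : ∀ {n} → SimpleGraph n → Fin n → ℕ
degree G v = length (filterᵇ (adj G v) (allFin _))

Cubic : ∀ {n} → SimpleGraph n → Set
Cubic {n} G = ∀ (v : Fin n) → degree G v ≡ 3

-- A general (abstract) graph: a vertex type with an adjacency relation.
-- Used so that colourings can be defined uniformly for G and for L(G).
record Graph : Set₁ where
  field
    V   : Set
    Adj : V → V → Set
open Graph public

toGraph : ∀ {n} → SimpleGraph n → Graph
toGraph {n} G = record { V = Fin n ; Adj = λ u v → T (adj G u v) }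

-- edges of G: unordered pairs {u,v}, represented uniquely as (u , v) with u < v
Edge : ∀ {n} → SimpleGraph n → Set
Edge {n} G = Σ[ uv ∈ Fin n × Fin n ] (toℕ (proj₁ uv) < toℕ (proj₂ uv) × T (adj G (proj₁ uv) (proj₂ uv)))

end₁ end₂ : ∀ {n} (G : SimpleGraph n) → Edge G → Fin n
end₁ G e = proj₁ (proj₁ e)
end₂ G e = proj₂ (proj₁ e)

LineGraph : ∀ {n} → SimpleGraph n → Graph
LineGraph G = let e₁ = end₁ G ; e₂ = end₂ G in record
  { V   = Edge G
  ; Adj = λ e f → ¬ (e₁ e ≡ e₁ f × e₂ e ≡ e₂ f)
                  × (e₁ e ≡ e₁ f ⊎ e₁ e ≡ e₂ f ⊎ e₂ e ≡ e₁ f ⊎ e₂ e ≡ e₂ f) }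

module _ (H : Graph) where

  IsColouring : (k : ℕ) → (V H → Fin k) → Set
  IsColouring k f = ∀ u v → Adj H u v → f u ≢ f v

  InClasses : ∀ {k} → (V H → Fin k) → Fin k → Fin k → V H → Set
  InClasses f a b v = f v ≡ a ⊎ f v ≡ b

  data Reach {k} (f : V H → Fin k) (a b : Fin k) : V H → V H → Set where
    here : ∀ {v} → InClasses f a b v → Reach f a b v v
    step : ∀ {u v w} → Reach f a b u v → Adj H v w → InClasses f a b w → Reach f a b u w

  -- the bicoloured component containing v is a star K_{1,q} (q ≥ 0):
  -- some vertex c of the component is an endpoint of every edge of the component
  -- (a connected simple graph is a star iff some vertex covers all its edges)
  ComponentIsStar : ∀ {k} → (V H → Fin k) → Fin k → Fin k → V H → Set
  ComponentIsStar f a b v =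
    Σ[ c ∈ V H ] (Reach f a b v c ×
      (∀ x y → Reach f a b v x → Reach f a b v y → Adj H x y → x ≡ c ⊎ y ≡ c))

  ComponentIsK1orK2 : ∀ {k} → (V H → Fin k) → Fin k → Fin k → V H → Set
  ComponentIsK1orK2 f a b v =
    ∀ x y z → Reach f a b v x → Reach f a b v y → Reach f a b v z →
      x ≡ y ⊎ y ≡ z ⊎ x ≡ z

  IsStarColouring : (k : ℕ) → (V H → Fin k) → Set
  IsStarColouring k f = IsColouring k f ×
    (∀ (a b : Fin k) → a ≢ b → ∀ v → InClasses f a b v → ComponentIsStar f a b v)

  IsDistTwoColouring : (k : ℕ) → (V H → Fin k) → Set
  IsDistTwoColouring k f = IsColouring k f ×
    (∀ (a b : Fin k) → a ≢ b → ∀ v → InClasses f a b v → ComponentIsK1orK2 f a b v)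

  StarColourable : ℕ → Set
  StarColourable k = ∃ λ (f : V H → Fin k) → IsStarColouring k f

  DistTwoColourable : ℕ → Set
  DistTwoColourable k = ∃ λ (f : V H → Fin k) → IsDistTwoColouring k f

  Bipartite : Set
  Bipartite = ∃ λ (f : V H → Fin 2) → IsColouring 2 f

-- Let f be a star 4-colouring of L(G), G cubic. The three edges at a vertex u get distinct colours,
-- so exactly one colour m(u) is missing at u. As no path of four edges alternates between two
-- colours, m is a proper colouring with distinct colours on vertices at distance two; hence the
-- colours m(u), m(x), m(y), m(z) of u and its neighbours are all different, and so are m(u) and the
-- edge colours at u. A finite check shows that the edge colours at u are then
-- oriented s (m u) (m w) for one orientation s = side(u) ∈ {0, 1}, and reading an edge from both
-- ends shows that side is a bipartition. Conversely, given a bipartition side and a distance-two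
-- 4-colouring g, the edge colouring uv ↦ oriented (side u) (g u) (g v) is proper and, by another
-- finite check, has no bicoloured P₄ in L(G); in a properly coloured graph without bicoloured P₄
-- every bicoloured component is a star.

{-# OPTIONS --safe #-}
module Submission where

open import Defs
open import Data.Nat using (ℕ; _<_)
open import Data.Fin using (Fin; toℕ)
open import Data.Fin.Patterns using (0F; 1F; 2F; 3F)
open import Data.Fin.Properties using (_≟_; all?; any?)
import Data.Fin.Properties as Fin
open import Data.Bool using (T)
open import Data.Bool.Properties using (T?; T-irrelevant)
open import Data.List using ([]; _∷_; length; filterᵇ; allFin)
open import Data.List.Membership.Propositional using (_∈_)
open import Data.List.Membership.Propositional.Properties using (∈-filter⁺; ∈-filter⁻; ∈-allFin)
open import Data.List.Relation.Unary.Any using (here; there)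
open import Data.List.Relation.Unary.All using ([]; _∷_)
open import Data.List.Relation.Unary.AllPairs using ([]; _∷_)
open import Data.List.Relation.Unary.Unique.Propositional using (Unique)
open import Data.List.Relation.Unary.Unique.Propositional.Properties using (filter⁺; allFin⁺)
open import Data.Empty using (⊥; ⊥-elim)
open import Data.Sum using (_⊎_; inj₁; inj₂)
open import Data.Product using (_×_; _,_; ∃; ∃-syntax; ∃₂; Σ; proj₁; proj₂)
open import Function using (_∘_)
open import Function.Bundles using (_⇔_; mk⇔)
open import Relation.Nullary using (¬_; ¬?; Dec; yes; no)
open import Relation.Nullary.Decidable using (_×-dec_; _⊎-dec_; _→-dec_; map′; toWitness)
open import Relation.Binary using (tri<; tri≈; tri>)
open import Relation.Binary.Definitions using (Symmetric; DecidableEquality)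
import Relation.Binary.Definitions as B
import Relation.Unary as U
open import Relation.Binary.PropositionalEquality
  using (_≡_; _≢_; refl; module ≡-Reasoning; sym; trans; cong; cong₂; subst; subst₂; ≢-sym)

Colour : Set
Colour = Fin 4

Distinct₄ : Colour → Colour → Colour → Colour → Set
Distinct₄ a b c d = a ≢ b × a ≢ c × a ≢ d × b ≢ c × b ≢ d × c ≢ d

distinct₄? : ∀ a b c d → Dec (Distinct₄ a b c d)
distinct₄? a b c d =
  ¬? (a ≟ b) ×-dec ¬? (a ≟ c) ×-dec ¬? (a ≟ d) ×-dec ¬? (b ≟ c) ×-dec ¬? (b ≟ d) ×-dec ¬? (c ≟ d)

Distinct₄-rotate : ∀ {a b c d} → Distinct₄ a b c d → Distinct₄ d a b c
Distinct₄-rotate (a≢b , a≢c , a≢d , b≢c , b≢d , c≢d) = ≢-sym a≢d , ≢-sym b≢d , ≢-sym c≢d , a≢b , a≢c , b≢c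

≢-fourth : ∀ {a b c d e} → Distinct₄ a b c d → e ≡ a ⊎ e ≡ b ⊎ e ≡ c → e ≢ d
≢-fourth (_ , _ , a≢d , _ , _ , _) (inj₁ refl)        = a≢d
≢-fourth (_ , _ , _ , _ , b≢d , _) (inj₂ (inj₁ refl)) = b≢d
≢-fourth (_ , _ , _ , _ , _ , c≢d) (inj₂ (inj₂ refl)) = c≢d

-- For p ≢ q, τ p q is the colour r such that (p, q, r, s) is an even permutation of (0, 1, 2, 3);
-- τ q p is then the remaining colour s.
τ : Colour → Colour → Colour
τ 0F 1F = 2F
τ 0F 2F = 3F
τ 0F 3F = 1F
τ 1F 0F = 3F
τ 1F 2F = 0F
τ 1F 3F = 2F
τ 2F 0F = 1F
τ 2F 1F = 3F
τ 2F 3F = 0F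
τ 3F 0F = 2F
τ 3F 1F = 0F
τ 3F 2F = 1F
τ _  _  = 0F

oriented : Fin 2 → Colour → Colour → Colour
oriented 0F p q = τ p q
oriented 1F p q = τ q p

oriented-swap : ∀ {s s'} → s ≢ s' → ∀ p q → oriented s p q ≡ oriented s' q p
oriented-swap {0F} {0F} 0≢0 = ⊥-elim (0≢0 refl)
oriented-swap {0F} {1F} _   = λ _ _ → refl
oriented-swap {1F} {0F} _   = λ _ _ → refl
oriented-swap {1F} {1F} 1≢1 = ⊥-elim (1≢1 refl)

-- Opaque, so that type checking never unfolds these exhaustive-search witnesses when they are
-- applied to open terms.
opaque
  fourth-colour : ∀ a b c → a ≢ b → a ≢ c → b ≢ c → ∃[ d ] Distinct₄ a b c d
  fourth-colour = toWitness {a? = all? λ a → all? λ b → all? λ c →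
    ¬? (a ≟ b) →-dec ¬? (a ≟ c) →-dec ¬? (b ≟ c) →-dec any? λ d → distinct₄? a b c d} _

  Distinct₄-cover : ∀ a b c d e → Distinct₄ a b c d → e ≢ d → e ≡ a ⊎ e ≡ b ⊎ e ≡ c
  Distinct₄-cover = toWitness {a? = all? λ a → all? λ b → all? λ c → all? λ d → all? λ e →
    distinct₄? a b c d →-dec ¬? (e ≟ d) →-dec (e ≟ a ⊎-dec e ≟ b ⊎-dec e ≟ c)} _

  two-other-colours : ∀ c d → c ≢ d → ∃₂ λ a b → Distinct₄ a b c d
  two-other-colours = toWitness {a? = all? λ c → all? λ d →
    ¬? (c ≟ d) →-dec any? λ a → any? λ b → distinct₄? a b c d} _

  oriented-asym : ∀ s p q → p ≢ q → oriented s p q ≢ oriented s q p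
  oriented-asym = toWitness {a? = all? λ s → all? λ p → all? λ q →
    ¬? (p ≟ q) →-dec ¬? (oriented s p q ≟ oriented s q p)} _

  oriented-injective : ∀ s p q q' → p ≢ q → p ≢ q' → q ≢ q' → oriented s p q ≢ oriented s p q'
  oriented-injective = toWitness {a? = all? λ s → all? λ p → all? λ q → all? λ q' →
    ¬? (p ≟ q) →-dec ¬? (p ≟ q') →-dec ¬? (q ≟ q') →-dec ¬? (oriented s p q ≟ oriented s p q')} _

  oriented-local : ∀ p q₁ q₂ q₃ d₁ d₂ d₃ → Distinct₄ p q₁ q₂ q₃ → Distinct₄ p d₁ d₂ d₃ →
    d₁ ≢ q₁ → d₂ ≢ q₂ → d₃ ≢ q₃ →
    ∃[ s ] (d₁ ≡ oriented s p q₁ × d₂ ≡ oriented s p q₂ × d₃ ≡ oriented s p q₃)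
  oriented-local = toWitness {a? = all? λ p → all? λ q₁ → all? λ q₂ → all? λ q₃ →
    all? λ d₁ → all? λ d₂ → all? λ d₃ →
    distinct₄? p q₁ q₂ q₃ →-dec distinct₄? p d₁ d₂ d₃ →-dec
    ¬? (d₁ ≟ q₁) →-dec ¬? (d₂ ≟ q₂) →-dec ¬? (d₃ ≟ q₃) →-dec
    any? λ s → d₁ ≟ oriented s p q₁ ×-dec d₂ ≟ oriented s p q₂ ×-dec d₃ ≟ oriented s p q₃} _

  oriented-¬alternating : ∀ s s' g₀ g₁ g₂ g₃ g₄ → s ≢ s' →
    g₀ ≢ g₁ → g₁ ≢ g₂ → g₂ ≢ g₃ → g₃ ≢ g₄ → g₀ ≢ g₂ → g₁ ≢ g₃ → g₂ ≢ g₄ →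
    oriented s g₀ g₁ ≡ oriented s g₂ g₃ → oriented s' g₁ g₂ ≢ oriented s' g₃ g₄
  oriented-¬alternating = toWitness {a? = all? λ s → all? λ s' → all? λ g₀ → all? λ g₁ →
    all? λ g₂ → all? λ g₃ → all? λ g₄ → ¬? (s ≟ s') →-dec
    ¬? (g₀ ≟ g₁) →-dec ¬? (g₁ ≟ g₂) →-dec ¬? (g₂ ≟ g₃) →-dec ¬? (g₃ ≟ g₄) →-dec
    ¬? (g₀ ≟ g₂) →-dec ¬? (g₁ ≟ g₃) →-dec ¬? (g₂ ≟ g₄) →-dec
    oriented s g₀ g₁ ≟ oriented s g₂ g₃ →-dec ¬? (oriented s' g₁ g₂ ≟ oriented s' g₃ g₄)} _

-- Bicoloured components

alternate : ∀ {k} {a b p q r : Fin k} → p ≡ a ⊎ p ≡ b → q ≡ a ⊎ q ≡ b → r ≡ a ⊎ r ≡ b →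
  p ≢ q → q ≢ r → p ≡ r
alternate (inj₁ refl) _          (inj₁ refl) _   _   = refl
alternate (inj₂ refl) _          (inj₂ refl) _   _   = refl
alternate (inj₁ refl) (inj₁ refl) (inj₂ refl) p≢q _   = ⊥-elim (p≢q refl)
alternate (inj₁ refl) (inj₂ refl) (inj₂ refl) _   q≢r = ⊥-elim (q≢r refl)
alternate (inj₂ refl) (inj₁ refl) (inj₁ refl) _   q≢r = ⊥-elim (q≢r refl)
alternate (inj₂ refl) (inj₂ refl) (inj₁ refl) p≢q _   = ⊥-elim (p≢q refl)

alternate₂ : ∀ {p q r : Fin 2} → p ≢ q → q ≢ r → p ≡ r
alternate₂ {p} {q} {r} = alternate (bit p) (bit q) (bit r)
  where
    bit : (s : Fin 2) → s ≡ 0F ⊎ s ≡ 1F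
    bit 0F = inj₁ refl
    bit 1F = inj₂ refl

module _ (H : Graph) {k : ℕ} (f : V H → Fin k) where

  DistanceTwoInjective : Set
  DistanceTwoInjective = ∀ {x w y} → Adj H x w → Adj H w y → x ≢ y → f x ≢ f y

  module _ (a b : Fin k) where

    reach-source : ∀ {v x} → Reach H f a b v x → InClasses H f a b v
    reach-source (here v∈) = v∈
    reach-source (step v⇝x _ _) = reach-source v⇝x

    reach-target : ∀ {v x} → Reach H f a b v x → InClasses H f a b x
    reach-target (here v∈) = v∈
    reach-target (step _ _ x∈) = x∈

    record BicolouredP₄ : Set where
      field
        v₁ v₂ v₃ v₄ : V H
        v₁~v₂ : Adj H v₁ v₂
        v₂~v₃ : Adj H v₂ v₃
        v₃~v₄ : Adj H v₃ v₄
        v₁∈ : InClasses H f a b v₁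
        v₂∈ : InClasses H f a b v₂
        v₃∈ : InClasses H f a b v₃
        v₄∈ : InClasses H f a b v₄
        v₁≢v₃ : v₁ ≢ v₃
        v₂≢v₄ : v₂ ≢ v₄

    module _ (proper : IsColouring H k f) where

      Adj⇒≢ : ∀ {x y} → Adj H x y → x ≢ y
      Adj⇒≢ {x} x~y refl = proper x x x~y refl

      bicoloured-triangle-free : ∀ {x y z} → Adj H x y → Adj H y z → Adj H x z →
        InClasses H f a b x → InClasses H f a b y → InClasses H f a b z → ⊥
      bicoloured-triangle-free {x} {y} {z} x~y y~z x~z x∈ y∈ z∈ =
        proper x z x~z (alternate x∈ y∈ z∈ (proper x y x~y) (proper y z y~z))

      star⇒¬BicolouredP₄ : (∀ v → InClasses H f a b v → ComponentIsStar H f a b v) →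
        ¬ BicolouredP₄
      star⇒¬BicolouredP₄ star p =
        go (covers v₁ v₂ ⇝v₁ ⇝v₂ v₁~v₂) (covers v₂ v₃ ⇝v₂ ⇝v₃ v₂~v₃) (covers v₃ v₄ ⇝v₃ ⇝v₄ v₃~v₄)
        where
          open BicolouredP₄ p
          c : V H
          c = proj₁ (star v₁ v₁∈)
          covers : ∀ x y → Reach H f a b v₁ x → Reach H f a b v₁ y → Adj H x y → x ≡ c ⊎ y ≡ c
          covers = proj₂ (proj₂ (star v₁ v₁∈))
          ⇝v₁ : Reach H f a b v₁ v₁
          ⇝v₁ = here v₁∈
          ⇝v₂ : Reach H f a b v₁ v₂
          ⇝v₂ = step ⇝v₁ v₁~v₂ v₂∈
          ⇝v₃ : Reach H f a b v₁ v₃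
          ⇝v₃ = step ⇝v₂ v₂~v₃ v₃∈
          ⇝v₄ : Reach H f a b v₁ v₄
          ⇝v₄ = step ⇝v₃ v₃~v₄ v₄∈
          go : v₁ ≡ c ⊎ v₂ ≡ c → v₂ ≡ c ⊎ v₃ ≡ c → v₃ ≡ c ⊎ v₄ ≡ c → ⊥
          go (inj₁ p) (inj₁ q) _        = Adj⇒≢ v₁~v₂ (trans p (sym q))
          go (inj₁ p) (inj₂ q) _        = v₁≢v₃ (trans p (sym q))
          go (inj₂ p) (inj₂ q) _        = Adj⇒≢ v₂~v₃ (trans p (sym q))
          go (inj₂ _) (inj₁ p) (inj₁ q) = Adj⇒≢ v₂~v₃ (trans p (sym q))
          go (inj₂ _) (inj₁ p) (inj₂ q) = v₂≢v₄ (trans p (sym q))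

      module _ (_≟_ : DecidableEquality (V H)) (Adj-sym : Symmetric (Adj H))
               (distance-two : DistanceTwoInjective) where

        reach-within-one : ∀ {v x} → Reach H f a b v x → x ≡ v ⊎ Adj H v x
        reach-within-one (here _) = inj₁ refl
        reach-within-one {v} (step {w = y} v⇝x x~y y∈) with reach-within-one v⇝x
        ... | inj₁ refl = inj₂ x~y
        ... | inj₂ v~x with y ≟ v
        ...   | yes y≡v = inj₁ y≡v
        ...   | no y≢v  = ⊥-elim (distance-two v~x x~y (λ v≡y → y≢v (sym v≡y))
                            (alternate (reach-source v⇝x) (reach-target v⇝x) y∈ (proper _ _ v~x) (proper _ _ x~y)))

        reach-colour-injective : ∀ {v x y} → Reach H f a b v x → Reach H f a b v y → f x ≡ f y → x ≡ y
        reach-colour-injective {v} {x} {y} v⇝x v⇝y fx≡fy with reach-within-one v⇝x | reach-within-one v⇝y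
        ... | inj₁ x≡v | inj₁ y≡v = trans x≡v (sym y≡v)
        ... | inj₁ refl | inj₂ v~y = ⊥-elim (proper _ _ v~y fx≡fy)
        ... | inj₂ v~x | inj₁ refl = ⊥-elim (proper _ _ v~x (sym fx≡fy))
        ... | inj₂ v~x | inj₂ v~y with x ≟ y
        ...   | yes x≡y = x≡y
        ...   | no x≢y  = ⊥-elim (distance-two (Adj-sym v~x) v~y x≢y fx≡fy)

        DistanceTwoInjective⇒K1orK2 : ∀ v → ComponentIsK1orK2 H f a b v
        DistanceTwoInjective⇒K1orK2 v x y z v⇝x v⇝y v⇝z with f x Fin.≟ f y | f y Fin.≟ f z
        ... | yes fx≡fy | _         = inj₁ (reach-colour-injective v⇝x v⇝y fx≡fy)
        ... | no _      | yes fy≡fz = inj₂ (inj₁ (reach-colour-injective v⇝y v⇝z fy≡fz))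
        ... | no fx≢fy  | no fy≢fz  = inj₂ (inj₂ (reach-colour-injective v⇝x v⇝z
                                        (alternate (reach-target v⇝x) (reach-target v⇝y) (reach-target v⇝z) fx≢fy fy≢fz)))

      module _ (_≟_ : DecidableEquality (V H)) (Adj-sym : Symmetric (Adj H))
               (Adj? : B.Decidable (Adj H)) (search : ∀ {P : V H → Set} → U.Decidable P → Dec (∃ P))
               (no-P₄ : ¬ BicolouredP₄) where

        OtherBicolouredNeighbour : V H → V H → Set
        OtherBicolouredNeighbour v u = ∃[ w ] (Adj H v w × InClasses H f a b w × w ≢ u)

        other-bicoloured-neighbour? : ∀ v u → Dec (OtherBicolouredNeighbour v u)
        other-bicoloured-neighbour? v u =
          search λ w → Adj? v w ×-dec (f w Fin.≟ a ⊎-dec f w Fin.≟ b) ×-dec ¬? (w ≟ u)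

        Dominates : V H → V H → Set
        Dominates v c = ∀ {x} → Reach H f a b v x → x ≡ c ⊎ Adj H c x

        dominating⇒star : ∀ {v c} → Reach H f a b v c → Dominates v c → ComponentIsStar H f a b v
        dominating⇒star {v} {c} v⇝c dominated = c , v⇝c , covers
          where
            covers : ∀ x y → Reach H f a b v x → Reach H f a b v y → Adj H x y → x ≡ c ⊎ y ≡ c
            covers x y v⇝x v⇝y x~y with dominated v⇝x | dominated v⇝y
            ... | inj₁ x≡c | _        = inj₁ x≡c
            ... | inj₂ _   | inj₁ y≡c = inj₂ y≡c
            ... | inj₂ c~x | inj₂ c~y = ⊥-elim (bicoloured-triangle-free (Adj-sym c~x) c~y x~y
                                          (reach-target v⇝x) (reach-target v⇝c) (reach-target v⇝y))

        -- A vertex y at distance two from c along x, together with another neighbour z of c,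
        -- would form a bicoloured P₄  z c x y.
        dominates : ∀ {v c} → InClasses H f a b c → v ≡ c ⊎ Adj H c v →
          (∀ {x y} → Adj H c x → InClasses H f a b x → Adj H x y → InClasses H f a b y → y ≢ c →
             OtherBicolouredNeighbour c x) →
          Dominates v c
        dominates c∈ start branch (here _) = start
        dominates {c = c} c∈ start branch (step {w = y} v⇝x x~y y∈) with dominates c∈ start branch v⇝x
        ... | inj₁ refl = inj₂ x~y
        ... | inj₂ c~x with y ≟ c
        ...   | yes y≡c = inj₁ y≡c
        ...   | no y≢c with branch c~x (reach-target v⇝x) x~y y∈ y≢c
        ...     | z , c~z , z∈ , z≢x = ⊥-elim (no-P₄ record
                    { v₁ = z ; v₂ = _ ; v₃ = _ ; v₄ = y ; v₁~v₂ = Adj-sym c~z ; v₂~v₃ = c~x ; v₃~v₄ = x~y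
                    ; v₁∈ = z∈ ; v₂∈ = c∈ ; v₃∈ = reach-target v⇝x ; v₄∈ = y∈
                    ; v₁≢v₃ = z≢x ; v₂≢v₄ = λ c≡y → y≢c (sym c≡y) })

        ¬BicolouredP₄⇒star : ∀ v → InClasses H f a b v → ComponentIsStar H f a b v
        ¬BicolouredP₄⇒star v v∈ with other-bicoloured-neighbour? v v
        ... | no isolated =
          dominating⇒star (here v∈) (dominates v∈ (inj₁ refl)
            λ v~x x∈ _ _ _ → ⊥-elim (isolated (_ , v~x , x∈ , λ x≡v → Adj⇒≢ v~x (sym x≡v))))
        ... | yes (w , v~w , w∈ , _) with other-bicoloured-neighbour? v w
        ...   | yes (w' , v~w' , w'∈ , w'≢w) = dominating⇒star (here v∈) (dominates v∈ (inj₁ refl) branch)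
          where
            branch : ∀ {x y} → Adj H v x → InClasses H f a b x → Adj H x y → InClasses H f a b y → y ≢ v →
              OtherBicolouredNeighbour v x
            branch {x} _ _ _ _ _ with x ≟ w
            ... | yes refl = w' , v~w' , w'∈ , w'≢w
            ... | no x≢w   = w , v~w , w∈ , λ w≡x → x≢w (sym w≡x)
        ...   | no unique = dominating⇒star (step (here v∈) v~w w∈) (dominates w∈ (inj₂ (Adj-sym v~w)) branch)
          where
            branch : ∀ {x y} → Adj H w x → InClasses H f a b x → Adj H x y → InClasses H f a b y → y ≢ w →
              OtherBicolouredNeighbour w x
            branch {x} w~x x∈ x~y y∈ y≢w with x ≟ v
            ... | yes refl = ⊥-elim (unique (_ , x~y , y∈ , y≢w))
            ... | no x≢v   = v , Adj-sym v~w , v∈ , λ v≡x → x≢v (sym v≡x)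

  K1orK2⇒DistanceTwoInjective : IsDistTwoColouring H k f → DistanceTwoInjective
  K1orK2⇒DistanceTwoInjective (proper , K1orK2) {x} {w} {y} x~w w~y x≢y fx≡fy
    with K1orK2 (f x) (f w) (proper x w x~w) x (inj₁ refl) x w y
           (here (inj₁ refl)) (step (here (inj₁ refl)) x~w (inj₂ refl))
           (step (step (here (inj₁ refl)) x~w (inj₂ refl)) w~y (inj₁ (sym fx≡fy)))
  ... | inj₁ x≡w        = proper x w x~w (cong f x≡w)
  ... | inj₂ (inj₁ w≡y) = proper w y w~y (cong f w≡y)
  ... | inj₂ (inj₂ x≡y) = x≢y x≡y

-- Edges and the line graph of a simple graph

module _ {n : ℕ} (G : SimpleGraph n) where

  infix 4 _~_ _∈ₑ_

  _~_ : Fin n → Fin n → Set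
  u ~ v = Adj (toGraph G) u v

  ~-sym : ∀ {u v} → u ~ v → v ~ u
  ~-sym {u} {v} = subst T (symm G u v)

  ~⇒≢ : ∀ {u v} → u ~ v → u ≢ v
  ~⇒≢ {u} u~u refl = subst T (irrefl G u) u~u

  data _∈ₑ_ (w : Fin n) (e : Edge G) : Set where
    at₁ : end₁ G e ≡ w → w ∈ₑ e
    at₂ : end₂ G e ≡ w → w ∈ₑ e

  edge-proof-irrelevant : ∀ {u v} (h h' : toℕ u < toℕ v × u ~ v) → h ≡ h'
  edge-proof-irrelevant (l , t) (l' , t') = cong₂ _,_ (Fin.<-irrelevant l l') (T-irrelevant t t')

  Edge-≡ : ∀ {e e'} → end₁ G e ≡ end₁ G e' → end₂ G e ≡ end₂ G e' → e ≡ e'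
  Edge-≡ {(u , v) , h} {(.u , .v) , h'} refl refl = cong ((u , v) ,_) (edge-proof-irrelevant h h')

  _≟ₑ_ : DecidableEquality (Edge G)
  e ≟ₑ e' with end₁ G e Fin.≟ end₁ G e' | end₂ G e Fin.≟ end₂ G e'
  ... | yes p  | yes q  = yes (Edge-≡ p q)
  ... | no ¬p  | _      = no (¬p ∘ cong (end₁ G))
  ... | yes _  | no ¬q  = no (¬q ∘ cong (end₂ G))

  search-edges : ∀ {P : Edge G → Set} → U.Decidable P → Dec (∃ P)
  search-edges {P} P? = map′ (λ (u , v , h , p) → ((u , v) , h) , p)
                             (λ (((u , v) , h) , p) → u , v , h , p)
                             (any? λ u → any? λ v → edge-from? u v)
    where
      edge-from? : ∀ u v → Dec (Σ (toℕ u < toℕ v × u ~ v) λ h → P ((u , v) , h))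
      edge-from? u v with u Fin.<? v ×-dec T? (adj G u v)
      ... | no ¬h = no (¬h ∘ proj₁)
      ... | yes h = map′ (h ,_) (λ (h' , p) → subst (P ∘ ((u , v) ,_)) (edge-proof-irrelevant h' h) p)
                             (P? ((u , v) , h))

  edge : ∀ {u v} → u ~ v → Edge G
  edge {u} {v} u~v with Fin.<-cmp u v
  ... | tri< u<v _ _ = (u , v) , u<v , u~v
  ... | tri≈ _ u≡v _ = ⊥-elim (~⇒≢ u~v u≡v)
  ... | tri> _ _ v<u = (v , u) , v<u , ~-sym u~v

  source∈edge : ∀ {u v} (u~v : u ~ v) → u ∈ₑ edge u~v
  source∈edge {u} {v} u~v with Fin.<-cmp u v
  ... | tri< _ _ _   = at₁ refl
  ... | tri≈ _ u≡v _ = ⊥-elim (~⇒≢ u~v u≡v)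
  ... | tri> _ _ _   = at₂ refl

  target∈edge : ∀ {u v} (u~v : u ~ v) → v ∈ₑ edge u~v
  target∈edge {u} {v} u~v with Fin.<-cmp u v
  ... | tri< _ _ _   = at₂ refl
  ... | tri≈ _ u≡v _ = ⊥-elim (~⇒≢ u~v u≡v)
  ... | tri> _ _ _   = at₁ refl

  ends-~ : ∀ e → end₁ G e ~ end₂ G e
  ends-~ e = proj₂ (proj₂ e)

  -- Ends are stored in increasing order, so two edges with the same two ends cannot list them crosswise.
  edge-unique : ∀ {u v e e'} → u ≢ v → u ∈ₑ e → v ∈ₑ e → u ∈ₑ e' → v ∈ₑ e' → e ≡ e'
  edge-unique u≢v (at₁ p) (at₁ q) _ _ = ⊥-elim (u≢v (trans (sym p) q))
  edge-unique u≢v (at₂ p) (at₂ q) _ _ = ⊥-elim (u≢v (trans (sym p) q))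
  edge-unique u≢v _ _ (at₁ p) (at₁ q) = ⊥-elim (u≢v (trans (sym p) q))
  edge-unique u≢v _ _ (at₂ p) (at₂ q) = ⊥-elim (u≢v (trans (sym p) q))
  edge-unique _ (at₁ p) (at₂ q) (at₁ p') (at₂ q') = Edge-≡ (trans p (sym p')) (trans q (sym q'))
  edge-unique _ (at₂ p) (at₁ q) (at₂ p') (at₁ q') = Edge-≡ (trans q (sym q')) (trans p (sym p'))
  edge-unique {e = e} {e'} _ (at₁ refl) (at₂ refl) (at₂ p') (at₁ q') =
    ⊥-elim (Fin.<-asym (proj₁ (proj₂ e)) (subst₂ (λ a b → toℕ a < toℕ b) q' p' (proj₁ (proj₂ e'))))
  edge-unique {e = e} {e'} _ (at₂ refl) (at₁ refl) (at₁ p') (at₂ q') =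
    ⊥-elim (Fin.<-asym (proj₁ (proj₂ e)) (subst₂ (λ a b → toℕ a < toℕ b) p' q' (proj₁ (proj₂ e'))))

  edge-cong : ∀ {u v u' v'} (u~v : u ~ v) (u'~v' : u' ~ v') → u ≡ u' → v ≡ v' → edge u~v ≡ edge u'~v'
  edge-cong u~v u'~v' refl refl =
    edge-unique (~⇒≢ u~v) (source∈edge u~v) (target∈edge u~v) (source∈edge u'~v') (target∈edge u'~v')

  edge-sym : ∀ {u v} (u~v : u ~ v) (v~u : v ~ u) → edge u~v ≡ edge v~u
  edge-sym u~v v~u =
    edge-unique (~⇒≢ u~v) (source∈edge u~v) (target∈edge u~v) (target∈edge v~u) (source∈edge v~u)

  other-end : ∀ {w e} → w ∈ₑ e → Fin n
  other-end {e = e} (at₁ _) = end₂ G e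
  other-end {e = e} (at₂ _) = end₁ G e

  other-end∈ : ∀ {w e} (w∈e : w ∈ₑ e) → other-end w∈e ∈ₑ e
  other-end∈ (at₁ _) = at₂ refl
  other-end∈ (at₂ _) = at₁ refl

  ~-other-end : ∀ {w e} (w∈e : w ∈ₑ e) → w ~ other-end w∈e
  ~-other-end {e = e} (at₁ refl) = ends-~ e
  ~-other-end {e = e} (at₂ refl) = ~-sym (ends-~ e)

  ∈ₑ-~ : ∀ {u v e} → u ∈ₑ e → v ∈ₑ e → u ≢ v → u ~ v
  ∈ₑ-~ (at₁ refl) (at₁ refl) u≢v = ⊥-elim (u≢v refl)
  ∈ₑ-~ (at₂ refl) (at₂ refl) u≢v = ⊥-elim (u≢v refl)
  ∈ₑ-~ {e = e} (at₁ refl) (at₂ refl) _ = ends-~ e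
  ∈ₑ-~ {e = e} (at₂ refl) (at₁ refl) _ = ~-sym (ends-~ e)

  _≈_ : Edge G → Edge G → Set
  _≈_ = Adj (LineGraph G)

  ≈-intro : ∀ {w e e'} → e ≢ e' → w ∈ₑ e → w ∈ₑ e' → e ≈ e'
  ≈-intro e≢e' w∈e w∈e' = (λ (p , q) → e≢e' (Edge-≡ p q)) , shares w∈e w∈e'
    where
      shares : ∀ {w e e'} → w ∈ₑ e → w ∈ₑ e' →
        end₁ G e ≡ end₁ G e' ⊎ end₁ G e ≡ end₂ G e' ⊎ end₂ G e ≡ end₁ G e' ⊎ end₂ G e ≡ end₂ G e'
      shares (at₁ p) (at₁ q) = inj₁ (trans p (sym q))
      shares (at₁ p) (at₂ q) = inj₂ (inj₁ (trans p (sym q)))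
      shares (at₂ p) (at₁ q) = inj₂ (inj₂ (inj₁ (trans p (sym q))))
      shares (at₂ p) (at₂ q) = inj₂ (inj₂ (inj₂ (trans p (sym q))))

  ≈⇒≢ : ∀ {e e'} → e ≈ e' → e ≢ e'
  ≈⇒≢ (different , _) refl = different (refl , refl)

  ≈⇒common-end : ∀ {e e'} → e ≈ e' → ∃[ w ] (w ∈ₑ e × w ∈ₑ e')
  ≈⇒common-end {e} (_ , inj₁ p)               = end₁ G e , at₁ refl , at₁ (sym p)
  ≈⇒common-end {e} (_ , inj₂ (inj₁ p))        = end₁ G e , at₁ refl , at₂ (sym p)
  ≈⇒common-end {e} (_ , inj₂ (inj₂ (inj₁ p))) = end₂ G e , at₂ refl , at₁ (sym p)
  ≈⇒common-end {e} (_ , inj₂ (inj₂ (inj₂ p))) = end₂ G e , at₂ refl , at₂ (sym p)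

  ≈-sym : ∀ {e e'} → e ≈ e' → e' ≈ e
  ≈-sym {e} {e'} e≈e' with ≈⇒common-end {e} {e'} e≈e'
  ... | _ , w∈e , w∈e' = ≈-intro (≈⇒≢ {e} {e'} e≈e' ∘ sym) w∈e' w∈e

  _≈?_ : ∀ e e' → Dec (e ≈ e')
  e ≈? e' = ¬? (end₁ G e Fin.≟ end₁ G e' ×-dec end₂ G e Fin.≟ end₂ G e') ×-dec
            (end₁ G e Fin.≟ end₁ G e' ⊎-dec end₁ G e Fin.≟ end₂ G e' ⊎-dec
             end₂ G e Fin.≟ end₁ G e' ⊎-dec end₂ G e Fin.≟ end₂ G e')

  at-most-two-ends : ∀ {u v w e} → u ∈ₑ e → v ∈ₑ e → w ∈ₑ e → u ≡ v ⊎ v ≡ w ⊎ u ≡ w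
  at-most-two-ends (at₁ p) (at₁ q) _        = inj₁ (trans (sym p) q)
  at-most-two-ends (at₂ p) (at₂ q) _        = inj₁ (trans (sym p) q)
  at-most-two-ends (at₁ p) (at₂ _) (at₁ r) = inj₂ (inj₂ (trans (sym p) r))
  at-most-two-ends (at₂ p) (at₁ _) (at₂ r) = inj₂ (inj₂ (trans (sym p) r))
  at-most-two-ends (at₁ _) (at₂ q) (at₂ r) = inj₂ (inj₁ (trans (sym q) r))
  at-most-two-ends (at₂ _) (at₁ q) (at₁ r) = inj₂ (inj₁ (trans (sym q) r))

  edge-≡-middle : ∀ {x₀ x₁ x₂ x₃} (x₀~x₁ : x₀ ~ x₁) (x₁~x₂ : x₁ ~ x₂) (x₂~x₃ : x₂ ~ x₃) →
    edge x₀~x₁ ≡ edge x₂~x₃ → edge x₀~x₁ ≡ edge x₁~x₂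
  edge-≡-middle {x₂ = x₂} x₀~x₁ x₁~x₂ x₂~x₃ e₁≡e₃ =
    edge-unique (~⇒≢ x₁~x₂) (target∈edge x₀~x₁) (subst (x₂ ∈ₑ_) (sym e₁≡e₃) (source∈edge x₂~x₃))
                (source∈edge x₁~x₂) (target∈edge x₁~x₂)

  Disjoint : Edge G → Edge G → Set
  Disjoint e e' = ∀ {w} → w ∈ₑ e → w ∈ₑ e' → ⊥

  record Joins (e : Edge G) (u v : Fin n) : Set where
    constructor joins
    field
      source∈ : u ∈ₑ e
      target∈ : v ∈ₑ e
      adjacent : u ~ v

  record Path₄ (e₁ e₂ e₃ e₄ : Edge G) : Set where
    field
      x₀ x₁ x₂ x₃ x₄ : Fin n
      joins₁ : Joins e₁ x₀ x₁
      joins₂ : Joins e₂ x₁ x₂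
      joins₃ : Joins e₃ x₂ x₃
      joins₄ : Joins e₄ x₃ x₄
      x₀≢x₂ : x₀ ≢ x₂
      x₁≢x₃ : x₁ ≢ x₃
      x₂≢x₄ : x₂ ≢ x₄

  disjoint-walk⇒path : ∀ {e₁ e₂ e₃ e₄} → e₁ ≈ e₂ → e₂ ≈ e₃ → e₃ ≈ e₄ →
    Disjoint e₁ e₃ → Disjoint e₂ e₄ → Path₄ e₁ e₂ e₃ e₄
  disjoint-walk⇒path {e₁} {e₂} {e₃} {e₄} e₁≈e₂ e₂≈e₃ e₃≈e₄ e₁∩e₃=∅ e₂∩e₄=∅
    with ≈⇒common-end {e₁} {e₂} e₁≈e₂ | ≈⇒common-end {e₂} {e₃} e₂≈e₃ | ≈⇒common-end {e₃} {e₄} e₃≈e₄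
  ... | x₁ , x₁∈e₁ , x₁∈e₂ | x₂ , x₂∈e₂ , x₂∈e₃ | x₃ , x₃∈e₃ , x₃∈e₄ = record
    { x₀ = other-end x₁∈e₁ ; x₁ = x₁ ; x₂ = x₂ ; x₃ = x₃ ; x₄ = other-end x₃∈e₄
    ; joins₁ = joins (other-end∈ x₁∈e₁) x₁∈e₁ (~-sym (~-other-end x₁∈e₁))
    ; joins₂ = joins x₁∈e₂ x₂∈e₂ (∈ₑ-~ x₁∈e₂ x₂∈e₂ x₁≢x₂)
    ; joins₃ = joins x₂∈e₃ x₃∈e₃ (∈ₑ-~ x₂∈e₃ x₃∈e₃ x₂≢x₃)
    ; joins₄ = joins x₃∈e₄ (other-end∈ x₃∈e₄) (~-other-end x₃∈e₄)
    ; x₀≢x₂ = λ { refl → e₁∩e₃=∅ (other-end∈ x₁∈e₁) x₂∈e₃ }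
    ; x₁≢x₃ = λ { refl → e₂∩e₄=∅ x₁∈e₂ x₃∈e₄ }
    ; x₂≢x₄ = λ { refl → e₂∩e₄=∅ x₂∈e₂ (other-end∈ x₃∈e₄) }
    }
    where
      x₁≢x₂ : x₁ ≢ x₂
      x₁≢x₂ refl = e₁∩e₃=∅ x₁∈e₁ x₂∈e₃
      x₂≢x₃ : x₂ ≢ x₃
      x₂≢x₃ refl = e₂∩e₄=∅ x₂∈e₂ x₃∈e₄

  record Neighbourhood (v : Fin n) : Set where
    field
      x y z : Fin n
      v~x : v ~ x
      v~y : v ~ y
      v~z : v ~ z
      x≢y : x ≢ y
      x≢z : x ≢ z
      y≢z : y ≢ z
      complete : ∀ {w} → v ~ w → w ≡ x ⊎ w ≡ y ⊎ w ≡ z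

  neighbour-elim : ∀ {v} (N : Neighbourhood v) (P : Fin n → Set) → let open Neighbourhood N in
    P x → P y → P z → ∀ {w} → v ~ w → P w
  neighbour-elim N P px py pz v~w with Neighbourhood.complete N v~w
  ... | inj₁ w≡x        = subst P (sym w≡x) px
  ... | inj₂ (inj₁ w≡y) = subst P (sym w≡y) py
  ... | inj₂ (inj₂ w≡z) = subst P (sym w≡z) pz

  -- Opaque: unfolding the filtered adjacency list of a variable graph makes type checking explode.
  opaque
    neighbourhood : Cubic G → ∀ v → Neighbourhood v
    neighbourhood cubic v = from-list (filterᵇ (adj G v) (allFin n)) (cubic v)
      (filter⁺ (T? ∘ adj G v) (allFin⁺ n))
      (proj₂ ∘ ∈-filter⁻ (T? ∘ adj G v) {xs = allFin n})
      (∈-filter⁺ (T? ∘ adj G v) (∈-allFin _))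
      where
        from-list : ∀ ws → length ws ≡ 3 → Unique ws → (∀ {w} → w ∈ ws → v ~ w) → (∀ {w} → v ~ w → w ∈ ws) →
          Neighbourhood v
        from-list (x ∷ y ∷ z ∷ []) refl ((x≢y ∷ x≢z ∷ []) ∷ (y≢z ∷ []) ∷ [] ∷ []) sound complete = record
          { x = x ; y = y ; z = z
          ; v~x = sound (here refl) ; v~y = sound (there (here refl)) ; v~z = sound (there (there (here refl)))
          ; x≢y = x≢y ; x≢z = x≢z ; y≢z = y≢z
          ; complete = λ v~w → one-of (complete v~w)
          }
          where
            one-of : ∀ {w} → w ∈ x ∷ y ∷ z ∷ [] → w ≡ x ⊎ w ≡ y ⊎ w ≡ z
            one-of (here w≡x)                 = inj₁ w≡x
            one-of (there (here w≡y))         = inj₂ (inj₁ w≡y)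
            one-of (there (there (here w≡z))) = inj₂ (inj₂ w≡z)

  module FromStarColouring (cubic : Cubic G) (f : Edge G → Colour)
                           (f-star : IsStarColouring (LineGraph G) 4 f) where

    proper : IsColouring (LineGraph G) 4 f
    proper = proj₁ f-star

    Coloured : Fin n → Fin n → Colour → Set
    Coloured u v c = Σ (u ~ v) λ u~v → f (edge u~v) ≡ c

    Coloured-sym : ∀ {u v c} → Coloured u v c → Coloured v u c
    Coloured-sym (u~v , ≡c) = ~-sym u~v , trans (cong f (sym (edge-sym u~v (~-sym u~v)))) ≡c

    edge-colours-distinct : ∀ {u x y} (u~x : u ~ x) (u~y : u ~ y) → x ≢ y → f (edge u~x) ≢ f (edge u~y)
    edge-colours-distinct {u} u~x u~y x≢y = proper _ _ (≈-intro edges-distinct (source∈edge u~x) (source∈edge u~y))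
      where
        edges-distinct : edge u~x ≢ edge u~y
        edges-distinct e≡e' with at-most-two-ends (source∈edge u~y) (subst (_ ∈ₑ_) e≡e' (target∈edge u~x))
                                                  (target∈edge u~y)
        ... | inj₁ u≡x        = ~⇒≢ u~x u≡x
        ... | inj₂ (inj₁ x≡y) = x≢y x≡y
        ... | inj₂ (inj₂ u≡y) = ~⇒≢ u~y u≡y

    no-alternating-path : ∀ {x₀ x₁ x₂ x₃ x₄ a b} →
      Coloured x₀ x₁ a → Coloured x₁ x₂ b → Coloured x₂ x₃ a → Coloured x₃ x₄ b → a ≢ b → ⊥
    no-alternating-path {a = a} {b} (x₀~x₁ , ≡a) (x₁~x₂ , ≡b) (x₂~x₃ , ≡a') (x₃~x₄ , ≡b') a≢b =
      star⇒¬BicolouredP₄ (LineGraph G) f a b proper (proj₂ f-star a b a≢b) record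
        { v₁ = edge x₀~x₁ ; v₂ = edge x₁~x₂ ; v₃ = edge x₂~x₃ ; v₄ = edge x₃~x₄
        ; v₁~v₂ = ≈-intro (differ ≡a ≡b) (target∈edge x₀~x₁) (source∈edge x₁~x₂)
        ; v₂~v₃ = ≈-intro (differ ≡a' ≡b ∘ sym) (target∈edge x₁~x₂) (source∈edge x₂~x₃)
        ; v₃~v₄ = ≈-intro (differ ≡a' ≡b') (target∈edge x₂~x₃) (source∈edge x₃~x₄)
        ; v₁∈ = inj₁ ≡a ; v₂∈ = inj₂ ≡b ; v₃∈ = inj₁ ≡a' ; v₄∈ = inj₂ ≡b'
        ; v₁≢v₃ = differ ≡a ≡b ∘ edge-≡-middle x₀~x₁ x₁~x₂ x₂~x₃
        ; v₂≢v₄ = differ ≡a' ≡b ∘ sym ∘ edge-≡-middle x₁~x₂ x₂~x₃ x₃~x₄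
        }
      where
        differ : ∀ {e e'} → f e ≡ a → f e' ≡ b → e ≢ e'
        differ fe≡a fe'≡b refl = a≢b (trans (sym fe≡a) fe'≡b)

    module Around (u : Fin n) where
      open Neighbourhood (neighbourhood cubic u) public

      c₁ c₂ c₃ : Colour
      c₁ = f (edge v~x)
      c₂ = f (edge v~y)
      c₃ = f (edge v~z)

      fourth : ∃[ m ] Distinct₄ c₁ c₂ c₃ m
      fourth = fourth-colour c₁ c₂ c₃
        (edge-colours-distinct v~x v~y x≢y) (edge-colours-distinct v~x v~z x≢z) (edge-colours-distinct v~y v~z y≢z)

      edge-colour : ∀ {w} (u~w : u ~ w) → f (edge u~w) ≡ c₁ ⊎ f (edge u~w) ≡ c₂ ⊎ f (edge u~w) ≡ c₃
      edge-colour u~w = neighbour-elim (neighbourhood cubic u) P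
        (λ u~x → inj₁ (cong f (edge-cong u~x v~x refl refl)))
        (λ u~y → inj₂ (inj₁ (cong f (edge-cong u~y v~y refl refl))))
        (λ u~z → inj₂ (inj₂ (cong f (edge-cong u~z v~z refl refl))))
        u~w u~w
        where
          P : Fin n → Set
          P w = (u~w : u ~ w) → f (edge u~w) ≡ c₁ ⊎ f (edge u~w) ≡ c₂ ⊎ f (edge u~w) ≡ c₃

    missing : Fin n → Colour
    missing u = proj₁ (Around.fourth u)

    missing-absent : ∀ {u w c} → Coloured u w c → c ≢ missing u
    missing-absent {u} (u~w , refl) = ≢-fourth (proj₂ (Around.fourth u)) (Around.edge-colour u u~w)

    missing-present : ∀ {u c} → c ≢ missing u → ∃[ w ] Coloured u w c
    missing-present {u} {c} c≢m with Distinct₄-cover _ _ _ _ c (proj₂ fourth) c≢m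
      where open Around u
    ... | inj₁ c≡c₁        = _ , Around.v~x u , sym c≡c₁
    ... | inj₂ (inj₁ c≡c₂) = _ , Around.v~y u , sym c≡c₂
    ... | inj₂ (inj₂ c≡c₃) = _ , Around.v~z u , sym c≡c₃

    missing-forced : ∀ {x₁ x₂ x₃ x₄ a b} →
      Coloured x₁ x₂ a → Coloured x₂ x₃ b → Coloured x₃ x₄ a → a ≢ b → missing x₁ ≡ b
    missing-forced {x₁} {b = b} x₁x₂ x₂x₃ x₃x₄ a≢b with missing x₁ ≟ b
    ... | yes m≡b = m≡b
    ... | no m≢b with missing-present (m≢b ∘ sym)
    ...   | _ , x₁x₀ = ⊥-elim (no-alternating-path (Coloured-sym x₁x₀) x₁x₂ x₂x₃ x₃x₄ (≢-sym a≢b))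

    missing-proper : ∀ {u v} → u ~ v → missing u ≢ missing v
    missing-proper {u} {v} u~v mu≡mv = avoid (two-other-colours c (missing u) (missing-absent uv))
      where
        c : Colour
        c = f (edge u~v)
        uv : Coloured u v c
        uv = u~v , refl
        avoid : (∃₂ λ a b → Distinct₄ a b c (missing u)) → ⊥
        avoid (a , b , a≢b , a≢c , a≢m , b≢c , b≢m , _)
          with missing-present {u} a≢m | missing-present {u} b≢m
             | missing-present {v} (a≢m ∘ (λ a≡mv → trans a≡mv (sym mu≡mv)))
             | missing-present {v} (b≢m ∘ (λ b≡mv → trans b≡mv (sym mu≡mv)))
        ... | uₐ , u-uₐ | u_b , u-u_b | _ , v-vₐ | _ , v-v_b
          with missing-present {uₐ} (b≢c ∘ λ b≡m → trans b≡m (missing-forced (Coloured-sym u-uₐ) uv v-vₐ a≢c))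
             | missing-present {u_b} (a≢c ∘ λ a≡m → trans a≡m (missing-forced (Coloured-sym u-u_b) uv v-v_b b≢c))
        ...   | _ , uₐ-w | _ , u_b-z =
          no-alternating-path (Coloured-sym u_b-z) (Coloured-sym u-u_b) u-uₐ uₐ-w a≢b

    missing-distance-two : ∀ {u x y} → u ~ x → u ~ y → x ≢ y → missing x ≢ missing y
    missing-distance-two {u} u~x u~y x≢y mx≡my
      with missing-present (λ cy≡mx → missing-absent (Coloured-sym (u~y , refl)) (trans cy≡mx mx≡my))
         | missing-present (λ cx≡my → missing-absent (Coloured-sym (u~x , refl)) (trans cx≡my (sym mx≡my)))
    ... | _ , x-x' | _ , y-y' =
      no-alternating-path (Coloured-sym x-x') (Coloured-sym (u~x , refl)) (u~y , refl) y-y'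
                          (≢-sym (edge-colours-distinct u~x u~y x≢y))

    orientation : ∀ u → let open Around u in ∃[ s ]
      (c₁ ≡ oriented s (missing u) (missing x) × c₂ ≡ oriented s (missing u) (missing y) ×
       c₃ ≡ oriented s (missing u) (missing z))
    orientation u = oriented-local (missing u) (missing x) (missing y) (missing z) c₁ c₂ c₃
      (missing-proper v~x , missing-proper v~y , missing-proper v~z ,
       missing-distance-two v~x v~y x≢y , missing-distance-two v~x v~z x≢z , missing-distance-two v~y v~z y≢z)
      (Distinct₄-rotate (proj₂ fourth))
      (missing-absent (Coloured-sym (v~x , refl))) (missing-absent (Coloured-sym (v~y , refl)))
      (missing-absent (Coloured-sym (v~z , refl)))
      where open Around u

    side : Fin n → Fin 2
    side u = proj₁ (orientation u)

    edge-oriented : ∀ {u w} (u~w : u ~ w) → f (edge u~w) ≡ oriented (side u) (missing u) (missing w)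
    edge-oriented {u} u~w = neighbour-elim (neighbourhood cubic u) OrientedTowards
      (λ u~x → trans (cong f (edge-cong u~x v~x refl refl)) c₁≡)
      (λ u~y → trans (cong f (edge-cong u~y v~y refl refl)) c₂≡)
      (λ u~z → trans (cong f (edge-cong u~z v~z refl refl)) c₃≡)
      u~w u~w
      where
        open Around u
        c₁≡ : c₁ ≡ oriented (side u) (missing u) (missing x)
        c₁≡ = proj₁ (proj₂ (orientation u))
        c₂≡ : c₂ ≡ oriented (side u) (missing u) (missing y)
        c₂≡ = proj₁ (proj₂ (proj₂ (orientation u)))
        c₃≡ : c₃ ≡ oriented (side u) (missing u) (missing z)
        c₃≡ = proj₂ (proj₂ (proj₂ (orientation u)))
        OrientedTowards : Fin n → Set
        OrientedTowards w = (u~w : u ~ w) → f (edge u~w) ≡ oriented (side u) (missing u) (missing w)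

    side-proper : ∀ {u v} → u ~ v → side u ≢ side v
    side-proper {u} {v} u~v su≡sv = oriented-asym (side u) (missing u) (missing v) (missing-proper u~v) (begin
      oriented (side u) (missing u) (missing v) ≡⟨ edge-oriented u~v ⟨
      f (edge u~v)                              ≡⟨ cong f (edge-sym u~v (~-sym u~v)) ⟩
      f (edge (~-sym u~v))                      ≡⟨ edge-oriented (~-sym u~v) ⟩
      oriented (side v) (missing v) (missing u) ≡⟨ cong (λ s → oriented s (missing v) (missing u)) su≡sv ⟨
      oriented (side u) (missing v) (missing u) ∎)
      where open ≡-Reasoning

    bipartite : Bipartite (toGraph G)
    bipartite = side , λ _ _ → side-proper

    distanceTwoColourable : DistTwoColourable (toGraph G) 4
    distanceTwoColourable = missing , missing-colouring , λ a b _ v _ →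
      DistanceTwoInjective⇒K1orK2 (toGraph G) missing a b missing-colouring _≟_ ~-sym
        (λ x~w w~y → missing-distance-two (~-sym x~w) w~y) v
      where
        missing-colouring : IsColouring (toGraph G) 4 missing
        missing-colouring _ _ = missing-proper


  module FromBipartiteDistanceTwoColouring (side : Fin n → Fin 2) (side-proper : IsColouring (toGraph G) 2 side)
                               (g : Fin n → Colour) (g-distTwo : IsDistTwoColouring (toGraph G) 4 g) where

    g-proper : IsColouring (toGraph G) 4 g
    g-proper = proj₁ g-distTwo

    g-distance-two : DistanceTwoInjective (toGraph G) g
    g-distance-two = K1orK2⇒DistanceTwoInjective (toGraph G) g g-distTwo

    f : Edge G → Colour
    f e = oriented (side (end₁ G e)) (g (end₁ G e)) (g (end₂ G e))

    f-joins : ∀ {e u v} → Joins e u v → f e ≡ oriented (side u) (g u) (g v)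
    f-joins         (joins (at₁ refl) (at₂ refl) _)   = refl
    f-joins {e = e} (joins (at₂ refl) (at₁ refl) _)   = oriented-swap (side-proper _ _ (ends-~ e)) _ _
    f-joins         (joins (at₁ refl) (at₁ refl) u~u) = ⊥-elim (~⇒≢ u~u refl)
    f-joins         (joins (at₂ refl) (at₂ refl) u~u) = ⊥-elim (~⇒≢ u~u refl)

    f-proper : IsColouring (LineGraph G) 4 f
    f-proper e e' e≈e' fe≡fe' with ≈⇒common-end {e} {e'} e≈e'
    ... | w , w∈e , w∈e' = oriented-injective (side w) (g w) (g x) (g x')
      (g-proper _ _ w~x) (g-proper _ _ w~x') (g-distance-two (~-sym w~x) w~x' x≢x') (begin
        oriented (side w) (g w) (g x)  ≡⟨ f-joins (joins w∈e (other-end∈ w∈e) w~x) ⟨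
        f e                            ≡⟨ fe≡fe' ⟩
        f e'                           ≡⟨ f-joins (joins w∈e' (other-end∈ w∈e') w~x') ⟩
        oriented (side w) (g w) (g x') ∎)
      where
        open ≡-Reasoning
        x x' : Fin n
        x = other-end w∈e
        x' = other-end w∈e'
        w~x : w ~ x
        w~x = ~-other-end w∈e
        w~x' : w ~ x'
        w~x' = ~-other-end w∈e'
        x≢x' : x ≢ x'
        x≢x' x≡x' = ≈⇒≢ {e} {e'} e≈e' (edge-unique (~⇒≢ w~x) w∈e (other-end∈ w∈e) w∈e'
                                         (subst (_∈ₑ e') (sym x≡x') (other-end∈ w∈e')))

    ¬BicolouredP₄ : ∀ a b → ¬ BicolouredP₄ (LineGraph G) f a b
    ¬BicolouredP₄ a b p = oriented-¬alternating (side x₀) (side x₁) (g x₀) (g x₁) (g x₂) (g x₃) (g x₄)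
      (side-proper _ _ x₀~x₁) (g-proper _ _ x₀~x₁) (g-proper _ _ x₁~x₂) (g-proper _ _ x₂~x₃) (g-proper _ _ x₃~x₄)
      (g-distance-two x₀~x₁ x₁~x₂ x₀≢x₂) (g-distance-two x₁~x₂ x₂~x₃ x₁≢x₃) (g-distance-two x₂~x₃ x₃~x₄ x₂≢x₄)
      (begin
        oriented (side x₀) (g x₀) (g x₁) ≡⟨ f-joins joins₁ ⟨
        f v₁                             ≡⟨ f₁≡f₃ ⟩
        f v₃                             ≡⟨ f-joins joins₃ ⟩
        oriented (side x₂) (g x₂) (g x₃) ≡⟨ cong (λ s → oriented s (g x₂) (g x₃)) side₀≡side₂ ⟨
        oriented (side x₀) (g x₂) (g x₃) ∎)
      (begin
        oriented (side x₁) (g x₁) (g x₂) ≡⟨ f-joins joins₂ ⟨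
        f v₂                             ≡⟨ f₂≡f₄ ⟩
        f v₄                             ≡⟨ f-joins joins₄ ⟩
        oriented (side x₃) (g x₃) (g x₄) ≡⟨ cong (λ s → oriented s (g x₃) (g x₄)) side₁≡side₃ ⟨
        oriented (side x₁) (g x₃) (g x₄) ∎)
      where
        open ≡-Reasoning
        open BicolouredP₄ p
        f₁≡f₃ : f v₁ ≡ f v₃
        f₁≡f₃ = alternate v₁∈ v₂∈ v₃∈ (f-proper v₁ v₂ v₁~v₂) (f-proper v₂ v₃ v₂~v₃)
        f₂≡f₄ : f v₂ ≡ f v₄
        f₂≡f₄ = alternate v₂∈ v₃∈ v₄∈ (f-proper v₂ v₃ v₂~v₃) (f-proper v₃ v₄ v₃~v₄)
        equal-colour⇒disjoint : ∀ {e e'} → e ≢ e' → f e ≡ f e' → Disjoint e e'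
        equal-colour⇒disjoint {e} {e'} e≢e' fe≡fe' w∈e w∈e' = f-proper e e' (≈-intro e≢e' w∈e w∈e') fe≡fe'
        open Path₄ (disjoint-walk⇒path v₁~v₂ v₂~v₃ v₃~v₄ (equal-colour⇒disjoint v₁≢v₃ f₁≡f₃)
                                                         (equal-colour⇒disjoint v₂≢v₄ f₂≡f₄))
        x₀~x₁ : x₀ ~ x₁
        x₀~x₁ = Joins.adjacent joins₁
        x₁~x₂ : x₁ ~ x₂
        x₁~x₂ = Joins.adjacent joins₂
        x₂~x₃ : x₂ ~ x₃
        x₂~x₃ = Joins.adjacent joins₃
        x₃~x₄ : x₃ ~ x₄
        x₃~x₄ = Joins.adjacent joins₄
        side₀≡side₂ : side x₀ ≡ side x₂
        side₀≡side₂ = alternate₂ (side-proper _ _ x₀~x₁) (side-proper _ _ x₁~x₂)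
        side₁≡side₃ : side x₁ ≡ side x₃
        side₁≡side₃ = alternate₂ (side-proper _ _ x₁~x₂) (side-proper _ _ x₂~x₃)

    starColourable : StarColourable (LineGraph G) 4
    starColourable = f , f-proper , λ a b _ →
      ¬BicolouredP₄⇒star (LineGraph G) f a b f-proper _≟ₑ_ (λ {e} {e'} → ≈-sym {e} {e'}) _≈?_ search-edges
        (¬BicolouredP₄ a b)

theorem11 : ∀ {n : ℕ} (G : SimpleGraph n) → Cubic G →
    (StarColourable (LineGraph G) 4 ⇔ (Bipartite (toGraph G) × DistTwoColourable (toGraph G) 4))
theorem11 G cubic = mk⇔
  (λ (f , f-star) → let open FromStarColouring G cubic f f-star in bipartite , distanceTwoColourable)
  (λ ((side , side-proper) , (g , g-distTwo)) → FromBipartiteDistanceTwoColouring.starColourable G side side-proper g g-distTwo)
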